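{- For every integer $k\ge3$ and every $\varepsilon>0$ there is $n_0$ such that every $k$-graph $G$ on $n\ge n_0$ vertices with $\delta_{k-2}(G)\ge(1/4+\varepsilon)\binom{n}{2}$ is $(k-2)$-connected.
   Context: A $k$-graph has a vertex set and $k$-element edges; $\delta_d(G)$ is the largest $m$ such that every $d$-set of vertices lies in at least $m$ edges. The $\ell$-line graph of $G$ is the graph on $E(G)$ where $e,f$ are adjacent iff $|e\cap f|\ge\ell$. A subgraph is $\ell$-connected if it has no isolated vertices and its edges induce a connected subgraph of the $\ell$-line graph.
   Formalization: The parameter ε ranges over the positive rationals. -}

module Defs where

open import Data.Nat using (ℕ; zero; suc; _∸_; _≤_)
open import Data.Bool using (Bool; true; false; T)
open import Data.Fin using (Fin)
open import Data.Fin.Subset using (Subset; _∈_; _⊆_; _∩_; ∣_∣)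
open import Data.Fin.Subset.Properties using (_⊆?_)
open import Data.Vec using ([]; _∷_)
open import Data.List using (List; []; _∷_; map; _++_; length; filter)
open import Data.Product using (Σ; _×_; ∃)
open import Relation.Binary.PropositionalEquality using (_≡_)
open import Relation.Binary.Construct.Closure.ReflexiveTransitive using (Star)
open import Relation.Nullary.Decidable using (_×-dec_; T?)

record KGraph (k n : ℕ) : Set where
  field
    edge    : Subset n → Bool
    uniform : ∀ (e : Subset n) → T (edge e) → ∣ e ∣ ≡ k
open KGraph public

allSubsets : (n : ℕ) → List (Subset n)
allSubsets zero    = [] ∷ []
allSubsets (suc n) = map (false ∷_) (allSubsets n) ++ map (true ∷_) (allSubsets n)

deg : ∀ {k n} → KGraph k n → Subset n → ℕ
deg G D = length (filter (λ e → T? (edge G e) ×-dec (D ⊆? e)) (allSubsets _))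

LineAdj : ∀ {k n} → KGraph k n → ℕ → Subset n → Subset n → Set
LineAdj G ℓ e f = T (edge G e) × T (edge G f) × ℓ ≤ ∣ e ∩ f ∣

IsConnected : ∀ {k n} → KGraph k n → ℕ → Set
IsConnected {n = n} G ℓ =
  (∀ (v : Fin n) → Σ (Subset n) λ e → T (edge G e) × v ∈ e)
  × (∀ (e f : Subset n) → T (edge G e) → T (edge G f) → Star (LineAdj G ℓ) e f)

-- For a (k−2)-set D let L(D), its link, be the set of vertices outside D lying in an
-- edge through D. Every edge through D is D plus two vertices of L(D), so
-- deg D ≤ C(|L(D)|, 2); as 4·C(a, 2) ≤ C(2a, 2), deg D > C(n, 2)/4 forces |L(D)| > n/2,
-- so any two links meet.
-- In particular every (k−2)-set, hence every vertex, lies in an edge. Given edges e, f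
-- with |e ∩ f| < k − 2, extend e ∩ f to a (k−3)-set S ⊆ e and pick u ∈ e ∖ S and
-- v ∈ f ∖ e. A common vertex x of the links of S + u and S + v gives edges
-- g ⊇ S + u + x and h ⊇ S + v + x; then e, g, h is a walk in the (k−2)-line graph and
-- h ∩ f ⊇ (e ∩ f) + v, so at most k − 2 such rounds reach f.

module Submission where

open import Defs

module Binomial where

  open import Data.Nat
  open import Data.Nat.Properties
  open import Data.Nat.Combinatorics using (_C_; nCk+nC[k+1]≡[n+1]C[k+1]; nC1≡n)
  open import Data.Nat.Solver using (module +-*-Solver)
  open import Function using (_∘_)
  open import Relation.Binary.PropositionalEquality

  [1+n]C2≡n+nC2 : ∀ n → suc n C 2 ≡ n + n C 2
  [1+n]C2≡n+nC2 n = trans (sym (nCk+nC[k+1]≡[n+1]C[k+1] n 1)) (cong (_+ n C 2) (nC1≡n n))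

  0<nC2 : ∀ {n} → 2 ≤ n → 0 < n C 2
  0<nC2 {suc (suc n)} (s≤s (s≤s _)) = subst (0 <_) (sym ([1+n]C2≡n+nC2 (suc n))) z<s

  nCk≤[1+n]Ck : ∀ n k → n C k ≤ suc n C k
  nCk≤[1+n]Ck n zero    = ≤-refl
  nCk≤[1+n]Ck n (suc k) = subst (n C suc k ≤_) (nCk+nC[k+1]≡[n+1]C[k+1] n k) (m≤n+m _ _)

  C-monoˡ-≤ : ∀ {m n} k → m ≤ n → m C k ≤ n C k
  C-monoˡ-≤ k = mono ∘ ≤⇒≤′
    where
    mono : ∀ {m n} → m ≤′ n → m C k ≤ n C k
    mono (≤′-reflexive refl) = ≤-refl
    mono (≤′-step m≤′n)      = ≤-trans (mono m≤′n) (nCk≤[1+n]Ck _ k)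

  4*[nC2]≤[n+n]C2 : ∀ n → 4 * (n C 2) ≤ (n + n) C 2
  4*[nC2]≤[n+n]C2 zero    = z≤n
  4*[nC2]≤[n+n]C2 (suc n) = begin
    4 * (suc n C 2)                        ≡⟨ cong (4 *_) ([1+n]C2≡n+nC2 n) ⟩
    4 * (n + n C 2)                        ≡⟨ *-distribˡ-+ 4 n (n C 2) ⟩
    4 * n + 4 * (n C 2)                    ≤⟨ +-mono-≤ 4n≤ (4*[nC2]≤[n+n]C2 n) ⟩
    (suc (n + n) + (n + n)) + (n + n) C 2  ≡⟨ +-assoc (suc (n + n)) (n + n) _ ⟩
    suc (n + n) + ((n + n) + (n + n) C 2)  ≡⟨ cong (suc (n + n) +_) ([1+n]C2≡n+nC2 (n + n)) ⟨
    suc (n + n) + suc (n + n) C 2          ≡⟨ [1+n]C2≡n+nC2 (suc (n + n)) ⟨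
    suc (suc (n + n)) C 2                  ≡⟨ cong (λ m → suc m C 2) (+-suc n n) ⟨
    (suc n + suc n) C 2                    ∎
    where
    open ≤-Reasoning
    4n≤ : 4 * n ≤ suc (n + n) + (n + n)
    4n≤ = ≤-trans (≤-reflexive (solve 1 (λ m → con 4 :* m := (m :+ m) :+ (m :+ m)) refl n))
                  (+-monoˡ-≤ (n + n) (n≤1+n (n + n)))
      where open +-*-Solver

  nC2<4*[aC2]⇒n<a+a : ∀ {n a} → n C 2 < 4 * (a C 2) → n < a + a
  nC2<4*[aC2]⇒n<a+a {a = a} lt = ≰⇒> λ a+a≤n →
    <⇒≱ lt (≤-trans (4*[nC2]≤[n+n]C2 a) (C-monoˡ-≤ 2 a+a≤n))

module QuarterBound where

  open import Data.Nat as ℕ using (suc)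
  open import Data.Nat.Coprimality using (1-coprimeTo) renaming (sym to coprime-sym)
  open import Data.Integer as ℤ using (+_)
  import Data.Integer.Properties as ℤ
  open import Data.Rational using (ℚ; _/_; _+_; _*_; _<_; _≤_; 0ℚ; Positive; toℚᵘ)
  open import Data.Rational.Properties
  import Data.Rational.Unnormalised as ℚᵘ
  import Data.Rational.Unnormalised.Properties as ℚᵘ
  open import Relation.Binary.PropositionalEquality

  toℚᵘ-/1 : ∀ m → toℚᵘ (+ m / 1) ≡ ℚᵘ.mkℚᵘ (+ m) 0
  toℚᵘ-/1 m = cong toℚᵘ (normalize-coprime (coprime-sym (1-coprimeTo m)))

  -- _/_ normalises, so the comparison is read off in ℚᵘ, where + m / 1 is mkℚᵘ (+ m) 0.
  ¼*c<d⇒c<4*d : ∀ {c d} → (+ 1 / 4) * (+ c / 1) < + d / 1 → c ℕ.< 4 ℕ.* d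
  ¼*c<d⇒c<4*d {c} {d} lt
    with ℚᵘ.*<* c<d*4 ← subst₂ ℚᵘ._<_ (cong (toℚᵘ (+ 1 / 4) ℚᵘ.*_) (toℚᵘ-/1 c)) (toℚᵘ-/1 d)
                           (ℚᵘ.<-respˡ-≃ (toℚᵘ-homo-* (+ 1 / 4) (+ c / 1)) (toℚᵘ-mono-< lt))
    = ℤ.drop‿+<+ (subst₂ ℤ._<_ (trans (ℤ.*-identityʳ _) (ℤ.*-identityˡ _))
                               (trans (ℤ.*-comm (+ d) (+ 4)) (sym (ℤ.pos-* 4 d))) c<d*4)

  quarter-bound : ∀ {ε c d} → 0ℚ < ε → 0 ℕ.< c → (+ 1 / 4 + ε) * (+ c / 1) ≤ + d / 1 → c ℕ.< 4 ℕ.* d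
  quarter-bound {ε} {suc c} {d} ε>0 _ le = ¼*c<d⇒c<4*d {d = d} (<-≤-trans ¼*c<[¼+ε]*c le)
    where
    instance
      c>0 : Positive (+ suc c / 1)
      c>0 = normalize-pos (suc c) 1
    ¼*c<[¼+ε]*c : (+ 1 / 4) * (+ suc c / 1) < (+ 1 / 4 + ε) * (+ suc c / 1)
    ¼*c<[¼+ε]*c = *-monoˡ-<-pos (+ suc c / 1)
                    (subst (_< + 1 / 4 + ε) (+-identityʳ (+ 1 / 4)) (+-monoʳ-< (+ 1 / 4) ε>0))

module SubsetProperties where

  open import Data.Fin using (Fin; zero; suc)
  open import Data.Fin.Subset
  open import Data.Fin.Subset.Properties
  open import Data.List using ([]; _∷_)
  open import Data.List.Membership.Propositional using () renaming (_∈_ to _∈ˡ_)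
  open import Data.List.Relation.Unary.Any using (here; there)
  open import Data.Nat using (zero; suc; _+_; _∸_; _≤_; _<_; s≤s; s<s⁻¹)
  open import Data.Nat.Properties
  open import Data.Product using (∃; _×_; _,_)
  open import Data.Sum using (inj₁; inj₂)
  open import Data.Vec using ([]; _∷_; here; there)
  open import Function using (id; _∘_)
  open import Relation.Binary.PropositionalEquality
  open import Relation.Nullary using (yes; no; contradiction)

  ∣p∪⁅x⁆∣≡1+∣p∣ : ∀ {n} (p : Subset n) x → x ∉ p → ∣ p ∪ ⁅ x ⁆ ∣ ≡ suc ∣ p ∣
  ∣p∪⁅x⁆∣≡1+∣p∣ (inside  ∷ p) zero    x∉p = contradiction here x∉p
  ∣p∪⁅x⁆∣≡1+∣p∣ (outside ∷ p) zero    _   = cong (suc ∘ ∣_∣) (∪-identityʳ p)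
  ∣p∪⁅x⁆∣≡1+∣p∣ (inside  ∷ p) (suc x) x∉p = cong suc (∣p∪⁅x⁆∣≡1+∣p∣ p x (x∉p ∘ there))
  ∣p∪⁅x⁆∣≡1+∣p∣ (outside ∷ p) (suc x) x∉p = ∣p∪⁅x⁆∣≡1+∣p∣ p x (x∉p ∘ there)

  there⁺ : ∀ {n} {p : Subset n} {s} → Nonempty p → Nonempty (s ∷ p)
  there⁺ (x , x∈p) = suc x , there x∈p

  n<∣p∣+∣q∣⇒p∩q≢∅ : ∀ {n} (p q : Subset n) → n < ∣ p ∣ + ∣ q ∣ → Nonempty (p ∩ q)
  n<∣p∣+∣q∣⇒p∩q≢∅ []            []            ()
  n<∣p∣+∣q∣⇒p∩q≢∅ (inside  ∷ p) (inside  ∷ q) _  = zero , here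
  n<∣p∣+∣q∣⇒p∩q≢∅ (outside ∷ p) (outside ∷ q) lt =
    there⁺ (n<∣p∣+∣q∣⇒p∩q≢∅ p q (<-trans (n<1+n _) lt))
  n<∣p∣+∣q∣⇒p∩q≢∅ (outside ∷ p) (inside  ∷ q) lt =
    there⁺ (n<∣p∣+∣q∣⇒p∩q≢∅ p q (s<s⁻¹ (<-≤-trans lt (≤-reflexive (+-suc ∣ p ∣ ∣ q ∣)))))
  n<∣p∣+∣q∣⇒p∩q≢∅ (inside  ∷ p) (outside ∷ q) lt =
    there⁺ (n<∣p∣+∣q∣⇒p∩q≢∅ p q (s<s⁻¹ lt))

  p∪⁅x⁆⊆q⁺ : ∀ {n} {p q : Subset n} {x} → p ⊆ q → x ∈ q → p ∪ ⁅ x ⁆ ⊆ q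
  p∪⁅x⁆⊆q⁺ {p = p} {x = x} p⊆q x∈q y∈ with x∈p∪q⁻ p ⁅ x ⁆ y∈
  ... | inj₁ y∈p   = p⊆q y∈p
  ... | inj₂ y∈⁅x⁆ rewrite x∈⁅y⁆⇒x≡y x y∈⁅x⁆ = x∈q

  p∪⁅x⁆⊆q⁻ : ∀ {n} {p q : Subset n} {x} → p ∪ ⁅ x ⁆ ⊆ q → p ⊆ q × x ∈ q
  p∪⁅x⁆⊆q⁻ {p = p} {x = x} p∪⁅x⁆⊆q = p∪⁅x⁆⊆q ∘ p⊆p∪q ⁅ x ⁆ , p∪⁅x⁆⊆q (q⊆p∪q p ⁅ x ⁆ (x∈⁅x⁆ x))

  p⊆q∩r⁺ : ∀ {n} {p q r : Subset n} → p ⊆ q → p ⊆ r → p ⊆ q ∩ r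
  p⊆q∩r⁺ p⊆q p⊆r x∈p = x∈p∩q⁺ (p⊆q x∈p , p⊆r x∈p)

  ∣p∣<∣q∣⇒∃∈q∖p : ∀ {n} {p q : Subset n} → ∣ p ∣ < ∣ q ∣ → ∃ λ x → x ∈ q × x ∉ p
  ∣p∣<∣q∣⇒∃∈q∖p {p = p} {q} lt with nonempty? (q ∩ ∁ p)
  ... | yes (x , x∈q∖p) with x∈q , x∈∁p ← x∈p∩q⁻ q (∁ p) x∈q∖p = x , x∈q , x∈∁p⇒x∉p x∈∁p
  ... | no q∖p≡∅ = contradiction (p⊆q⇒∣p∣≤∣q∣ q⊆p) (<⇒≱ lt)
    where
    q⊆p : q ⊆ p
    q⊆p {x} x∈q with x ∈? p
    ... | yes x∈p = x∈p
    ... | no  x∉p = contradiction (x , x∈p∩q⁺ (x∈q , x∉p⇒x∈∁p x∉p)) q∖p≡∅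

  ⊆-grow : ∀ {n} g {I X : Subset n} → I ⊆ X → g + ∣ I ∣ ≤ ∣ X ∣ →
           ∃ λ S → I ⊆ S × S ⊆ X × ∣ S ∣ ≡ g + ∣ I ∣
  ⊆-grow zero    {I} I⊆X _ = I , id , I⊆X , refl
  ⊆-grow (suc g) {I} {X} I⊆X le =
    let x , x∈X , x∉I     = ∣p∣<∣q∣⇒∃∈q∖p (≤-trans (s≤s (m≤n+m _ g)) le)
        g+∣I+x∣≡1+g+∣I∣   = trans (cong (g +_) (∣p∪⁅x⁆∣≡1+∣p∣ I x x∉I)) (+-suc g ∣ I ∣)
        S , I+x⊆S , S⊆X , ∣S∣ = ⊆-grow g (p∪⁅x⁆⊆q⁺ I⊆X x∈X) (subst (_≤ ∣ X ∣) (sym g+∣I+x∣≡1+g+∣I∣) le)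
    in S , I+x⊆S ∘ p⊆p∪q ⁅ x ⁆ , S⊆X , trans ∣S∣ g+∣I+x∣≡1+g+∣I∣

  ⊆-extend : ∀ {n} {I X : Subset n} {j} → I ⊆ X → ∣ I ∣ ≤ j → j ≤ ∣ X ∣ →
             ∃ λ S → I ⊆ S × S ⊆ X × ∣ S ∣ ≡ j
  ⊆-extend {I = I} {j = j} I⊆X ∣I∣≤j j≤∣X∣ =
    let S , I⊆S , S⊆X , ∣S∣ = ⊆-grow (j ∸ ∣ I ∣) I⊆X (subst (_≤ _) (sym (m∸n+n≡m ∣I∣≤j)) j≤∣X∣)
    in S , I⊆S , S⊆X , trans ∣S∣ (m∸n+n≡m ∣I∣≤j)

  n<∣p∣+∣p∣⇒n<∣q∣+∣q∣⇒p∩q≢∅ : ∀ {n} {p q : Subset n} →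
                               n < ∣ p ∣ + ∣ p ∣ → n < ∣ q ∣ + ∣ q ∣ → Nonempty (p ∩ q)
  n<∣p∣+∣p∣⇒n<∣q∣+∣q∣⇒p∩q≢∅ {p = p} {q} n<2∣p∣ n<2∣q∣ with ≤-total ∣ p ∣ ∣ q ∣
  ... | inj₁ ∣p∣≤∣q∣ = n<∣p∣+∣q∣⇒p∩q≢∅ p q (<-≤-trans n<2∣p∣ (+-monoʳ-≤ ∣ p ∣ ∣p∣≤∣q∣))
  ... | inj₂ ∣q∣≤∣p∣ = n<∣p∣+∣q∣⇒p∩q≢∅ p q (<-≤-trans n<2∣q∣ (+-monoˡ-≤ ∣ q ∣ ∣q∣≤∣p∣))

  ⊆⋃ : ∀ {n} {p : Subset n} {ps} → p ∈ˡ ps → p ⊆ ⋃ ps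
  ⊆⋃ (here refl)                = p⊆p∪q _
  ⊆⋃ {ps = q ∷ ps} (there p∈ps) = q⊆p∪q q (⋃ ps) ∘ ⊆⋃ p∈ps

  ∈⋃⁻ : ∀ {n} {x : Fin n} ps → x ∈ ⋃ ps → ∃ λ p → p ∈ˡ ps × x ∈ p
  ∈⋃⁻ []       x∈⊥ = contradiction x∈⊥ ∉⊥
  ∈⋃⁻ (p ∷ ps) x∈  with x∈p∪q⁻ p (⋃ ps) x∈
  ... | inj₁ x∈p = p , here refl , x∈p
  ... | inj₂ x∈⋃ with q , q∈ps , x∈q ← ∈⋃⁻ ps x∈⋃ = q , there q∈ps , x∈q

module SubsetCounting where

  open import Data.Bool using (true; false)
  open import Data.Fin.Subset using (Subset; _⊆_; _∪_; ∣_∣; inside; outside)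
  open import Data.Fin.Subset.Properties using (_⊆?_; drop-∷-⊆; ∣p∣≤∣x∷p∣; p⊆q⇒∣p∣≤∣q∣)
  open import Data.List using ([]; _∷_; map; _++_; length; filter)
  open import Data.List.Properties using (length-++; filter-++; filter-none; length-filter)
  open import Data.List.Membership.Propositional using () renaming (_∈_ to _∈ˡ_)
  open import Data.List.Membership.Propositional.Properties using (∈-map⁺; ∈-++⁺ˡ; ∈-++⁺ʳ)
  import Data.List.Relation.Unary.All as All
  open import Data.List.Relation.Unary.Any using (here)
  import Data.List.Relation.Binary.Sublist.Propositional as Sublist
  import Data.List.Relation.Binary.Sublist.Propositional.Properties as Sublistₚ
  open import Data.Nat using (ℕ; zero; suc; _+_; _≤_; _≟_)
  open import Data.Nat.Properties
  open import Data.Nat.Combinatorics using (_C_; nCk+nC[k+1]≡[n+1]C[k+1])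
  open import Data.Product using (_×_; _,_)
  open import Data.Vec using ([]; _∷_; here)
  open import Function using (id; case_of_)
  open import Relation.Binary.PropositionalEquality
  open import Relation.Nullary using (¬_; does)
  open import Relation.Nullary.Decidable using (_×-dec_)
  open import Relation.Unary using (Pred; Decidable)
  open Binomial using (C-monoˡ-≤)

  allSubsets-complete : ∀ {n} (s : Subset n) → s ∈ˡ allSubsets n
  allSubsets-complete []                  = here refl
  allSubsets-complete {suc n} (outside ∷ s) = ∈-++⁺ˡ (∈-map⁺ (outside ∷_) (allSubsets-complete s))
  allSubsets-complete {suc n} (inside  ∷ s) =
    ∈-++⁺ʳ (map (outside ∷_) (allSubsets n)) (∈-map⁺ (inside ∷_) (allSubsets-complete s))

  length-filter-map : ∀ {a b p} {A : Set a} {B : Set b} {P : Pred B p}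
                      (P? : Decidable P) (f : A → B) xs →
                      length (filter P? (map f xs)) ≡ length (filter (λ x → P? (f x)) xs)
  length-filter-map P? f []       = refl
  length-filter-map P? f (x ∷ xs) with does (P? (f x))
  ... | true  = cong suc (length-filter-map P? f xs)
  ... | false = length-filter-map P? f xs

  count : ∀ {n p} {P : Pred (Subset n) p} → Decidable P → ℕ
  count {n} P? = length (filter P? (allSubsets n))

  module _ {n p} {P : Pred (Subset n) p} (P? : Decidable P) where

    count-none : (∀ {s} → ¬ P s) → count P? ≡ 0
    count-none ¬P = cong length (filter-none P? (All.universal (λ _ → ¬P) (allSubsets n)))

    count-mono : ∀ {q} {Q : Pred (Subset n) q} (Q? : Decidable Q) →
                 (∀ {s} → P s → Q s) → count P? ≤ count Q?
    count-mono Q? P⇒Q = Sublistₚ.length-mono-≤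
      (Sublistₚ.filter⁺ P? Q? (λ { refl → P⇒Q }) (Sublist.⊆-reflexive (refl {x = allSubsets n})))

  module _ {n p} {P : Pred (Subset (suc n)) p} (P? : Decidable P) where

    count-∷ : count P? ≡ count (λ s → P? (outside ∷ s)) + count (λ s → P? (inside ∷ s))
    count-∷ = begin
      length (filter P? (map (outside ∷_) (allSubsets n) ++ map (inside ∷_) (allSubsets n)))
        ≡⟨ cong length (filter-++ P? (map (outside ∷_) (allSubsets n)) _) ⟩
      length (filter P? (map (outside ∷_) (allSubsets n)) ++ filter P? (map (inside ∷_) (allSubsets n)))
        ≡⟨ length-++ (filter P? (map (outside ∷_) (allSubsets n))) ⟩
      length (filter P? (map (outside ∷_) (allSubsets n))) +
      length (filter P? (map (inside ∷_) (allSubsets n)))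
        ≡⟨ cong₂ _+_ (length-filter-map P? (outside ∷_) (allSubsets n))
                     (length-filter-map P? (inside ∷_) (allSubsets n)) ⟩
      count (λ s → P? (outside ∷ s)) + count (λ s → P? (inside ∷ s)) ∎
      where open ≡-Reasoning

    count-outside∷ : (∀ {s} → ¬ P (inside ∷ s)) → count P? ≡ count (λ s → P? (outside ∷ s))
    count-outside∷ ¬P = begin
      count P?
        ≡⟨ count-∷ ⟩
      count (λ s → P? (outside ∷ s)) + count (λ s → P? (inside ∷ s))
        ≡⟨ cong (count (λ s → P? (outside ∷ s)) +_) (count-none (λ s → P? (inside ∷ s)) ¬P) ⟩
      count (λ s → P? (outside ∷ s)) + 0
        ≡⟨ +-identityʳ _ ⟩
      count (λ s → P? (outside ∷ s)) ∎
      where open ≡-Reasoning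

    count-inside∷ : (∀ {s} → ¬ P (outside ∷ s)) → count P? ≡ count (λ s → P? (inside ∷ s))
    count-inside∷ ¬P =
      trans count-∷ (cong (_+ count (λ s → P? (inside ∷ s))) (count-none (λ s → P? (outside ∷ s)) ¬P))

  Extension : ∀ {n} → Subset n → Subset n → ℕ → Subset n → Set
  Extension L Y j g = L ⊆ g × g ⊆ L ∪ Y × ∣ g ∣ ≡ j + ∣ L ∣

  extension? : ∀ {n} (L Y : Subset n) j → Decidable (Extension L Y j)
  extension? L Y j g = L ⊆? g ×-dec g ⊆? L ∪ Y ×-dec ∣ g ∣ ≟ j + ∣ L ∣

  Extension-∷⁻ : ∀ {n} {L Y g : Subset n} {b c s j j′} →
                 (∣ s ∷ g ∣ ≡ j + ∣ b ∷ L ∣ → ∣ g ∣ ≡ j′ + ∣ L ∣) →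
                 Extension (b ∷ L) (c ∷ Y) j (s ∷ g) → Extension L Y j′ g
  Extension-∷⁻ size (L⊆g , g⊆L∪Y , ∣g∣) = drop-∷-⊆ L⊆g , drop-∷-⊆ g⊆L∪Y , size ∣g∣

  count-extension≤∣Y∣Cj : ∀ {n} (L Y : Subset n) j → count (extension? L Y j) ≤ ∣ Y ∣ C j
  count-extension≤∣Y∣Cj []            []            zero    =
    length-filter (extension? [] [] 0) (allSubsets 0)
  count-extension≤∣Y∣Cj []            []            (suc j) =
    ≤-reflexive (count-none (extension? [] [] (suc j)) λ { {[]} (_ , _ , ()) })
  count-extension≤∣Y∣Cj (outside ∷ L) (outside ∷ Y) j       = begin
    count E?
      ≡⟨ count-outside∷ E? (λ (_ , g⊆L∪Y , _) → case g⊆L∪Y here of λ ()) ⟩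
    count (λ g → E? (outside ∷ g))
      ≤⟨ count-mono _ (extension? L Y j) (Extension-∷⁻ id) ⟩
    count (extension? L Y j)
      ≤⟨ count-extension≤∣Y∣Cj L Y j ⟩
    ∣ Y ∣ C j ∎
    where
    open ≤-Reasoning
    E? : Decidable (Extension (outside ∷ L) (outside ∷ Y) j)
    E? = extension? (outside ∷ L) (outside ∷ Y) j
  -- {c = c} is needed since the head of (inside ∷ L) ∪ (c ∷ Y) computes to inside.
  count-extension≤∣Y∣Cj (inside ∷ L) (c ∷ Y) j = begin
    count E?
      ≡⟨ count-inside∷ E? (λ (L⊆g , _) → case L⊆g here of λ ()) ⟩
    count (λ g → E? (inside ∷ g))
      ≤⟨ count-mono _ (extension? L Y j)
           (Extension-∷⁻ {c = c} λ ∣g∣ → suc-injective (trans ∣g∣ (+-suc j ∣ L ∣))) ⟩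
    count (extension? L Y j)
      ≤⟨ count-extension≤∣Y∣Cj L Y j ⟩
    ∣ Y ∣ C j
      ≤⟨ C-monoˡ-≤ j (∣p∣≤∣x∷p∣ c Y) ⟩
    ∣ c ∷ Y ∣ C j ∎
    where
    open ≤-Reasoning
    E? : Decidable (Extension (inside ∷ L) (c ∷ Y) j)
    E? = extension? (inside ∷ L) (c ∷ Y) j
  count-extension≤∣Y∣Cj (outside ∷ L) (inside ∷ Y) zero = begin
    count E?
      ≡⟨ count-outside∷ E? (λ (L⊆g , _ , ∣g∣) → <⇒≱ (≤-reflexive ∣g∣) (p⊆q⇒∣p∣≤∣q∣ (drop-∷-⊆ L⊆g))) ⟩
    count (λ g → E? (outside ∷ g))
      ≤⟨ count-mono _ (extension? L Y 0) (Extension-∷⁻ id) ⟩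
    count (extension? L Y 0)
      ≤⟨ count-extension≤∣Y∣Cj L Y 0 ⟩
    ∣ Y ∣ C 0 ∎
    where
    open ≤-Reasoning
    E? : Decidable (Extension (outside ∷ L) (inside ∷ Y) zero)
    E? = extension? (outside ∷ L) (inside ∷ Y) zero
  count-extension≤∣Y∣Cj (outside ∷ L) (inside ∷ Y) (suc j) = begin
    count E?
      ≡⟨ count-∷ E? ⟩
    count (λ g → E? (outside ∷ g)) +
    count (λ g → E? (inside ∷ g))
      ≤⟨ +-mono-≤
           (count-mono _ (extension? L Y (suc j)) (Extension-∷⁻ id))
           (count-mono _ (extension? L Y j) (Extension-∷⁻ suc-injective)) ⟩
    count (extension? L Y (suc j)) + count (extension? L Y j)
      ≤⟨ +-mono-≤ (count-extension≤∣Y∣Cj L Y (suc j)) (count-extension≤∣Y∣Cj L Y j) ⟩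
    ∣ Y ∣ C suc j + ∣ Y ∣ C j
      ≡⟨ +-comm (∣ Y ∣ C suc j) _ ⟩
    ∣ Y ∣ C j + ∣ Y ∣ C suc j
      ≡⟨ nCk+nC[k+1]≡[n+1]C[k+1] ∣ Y ∣ j ⟩
    suc ∣ Y ∣ C suc j ∎
    where
    open ≤-Reasoning
    E? : Decidable (Extension (outside ∷ L) (inside ∷ Y) (suc j))
    E? = extension? (outside ∷ L) (inside ∷ Y) (suc j)

module Links where

  open import Data.Bool using (T)
  open import Data.Fin.Subset using (Subset; _∈_; _∉_; _⊆_; _∩_; _∪_; ∁; ⋃; ∣_∣)
  open import Data.Fin.Subset.Properties
    using (_∈?_; _⊆?_; x∈p∩q⁺; x∈p∩q⁻; x∈p∪q⁺; x∉p⇒x∈∁p; x∈∁p⇒x∉p)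
  open import Data.List using (List; filter)
  open import Data.List.Membership.Propositional using () renaming (_∈_ to _∈ˡ_)
  open import Data.List.Membership.Propositional.Properties using (∈-filter⁺; ∈-filter⁻)
  open import Data.Nat using (_+_; _*_; _≤_; _<_)
  open import Data.Nat.Properties using (≤-trans; *-monoʳ-≤; <-≤-trans)
  open import Data.Nat.Combinatorics using (_C_)
  open import Data.Product using (∃; _×_; _,_)
  open import Data.Sum using (inj₁; inj₂)
  open import Relation.Binary.PropositionalEquality using (_≡_; trans; sym; cong)
  open import Relation.Nullary using (yes; no)
  open import Relation.Nullary.Decidable using (_×-dec_; T?)
  open import Relation.Unary using (Decidable)
  open Binomial using (nC2<4*[aC2]⇒n<a+a)
  open SubsetProperties using (⊆⋃; ∈⋃⁻)
  open SubsetCounting using (allSubsets-complete; count-mono; extension?; count-extension≤∣Y∣Cj)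

  module _ {k n} (G : KGraph k n) where

    through? : (D : Subset n) → Decidable (λ e → T (edge G e) × D ⊆ e)
    through? D e = T? (edge G e) ×-dec D ⊆? e

    edgesThrough : Subset n → List (Subset n)
    edgesThrough D = filter (through? D) (allSubsets n)

    link : Subset n → Subset n
    link D = ⋃ (edgesThrough D) ∩ ∁ D

    ∈-link⁻ : ∀ {D x} → x ∈ link D → x ∉ D × ∃ λ e → T (edge G e) × D ⊆ e × x ∈ e
    ∈-link⁻ {D} x∈linkD =
      let x∈⋃ , x∈∁D        = x∈p∩q⁻ _ (∁ D) x∈linkD
          e , e∈edges , x∈e  = ∈⋃⁻ (edgesThrough D) x∈⋃
          _ , e-edge , D⊆e   = ∈-filter⁻ (through? D) {xs = allSubsets n} e∈edges
      in x∈∁p⇒x∉p x∈∁D , e , e-edge , D⊆e , x∈e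

    ⊆-link : ∀ {D e} → T (edge G e) → D ⊆ e → e ⊆ D ∪ link D
    ⊆-link {D} {e} e-edge D⊆e {x} x∈e with x ∈? D
    ... | yes x∈D = x∈p∪q⁺ (inj₁ x∈D)
    ... | no  x∉D = x∈p∪q⁺ (inj₂ (x∈p∩q⁺ (⊆⋃ e∈edgesThrough x∈e , x∉p⇒x∈∁p x∉D)))
      where
      e∈edgesThrough : e ∈ˡ edgesThrough D
      e∈edgesThrough = ∈-filter⁺ (through? D) (allSubsets-complete e) (e-edge , D⊆e)

  deg≤∣link∣C2 : ∀ {d n} (G : KGraph (2 + d) n) {D} → ∣ D ∣ ≡ d → deg G D ≤ ∣ link G D ∣ C 2
  deg≤∣link∣C2 G {D} ∣D∣ = ≤-trans
    (count-mono (through? G D) (extension? D (link G D) 2) λ (e-edge , D⊆e) →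
      D⊆e , ⊆-link G e-edge D⊆e , trans (uniform G _ e-edge) (cong (2 +_) (sym ∣D∣)))
    (count-extension≤∣Y∣Cj D (link G D) 2)

  nC2<4deg⇒n<∣link∣+∣link∣ : ∀ {d n} (G : KGraph (2 + d) n) {D} → ∣ D ∣ ≡ d →
                             n C 2 < 4 * deg G D → n < ∣ link G D ∣ + ∣ link G D ∣
  nC2<4deg⇒n<∣link∣+∣link∣ G {D} ∣D∣ lt =
    nC2<4*[aC2]⇒n<a+a {a = ∣ link G D ∣} (<-≤-trans lt (*-monoʳ-≤ 4 (deg≤∣link∣C2 G ∣D∣)))

module Codegree where

  open import Data.Fin.Subset using (_∩_; ∣_∣; Nonempty)
  open import Data.Integer using (+_)
  open import Data.Nat using (_+_; _≤_; _<_)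
  open import Data.Nat.Combinatorics using (_C_)
  open import Data.Rational as ℚ using (_/_; 0ℚ)
  open import Relation.Binary.PropositionalEquality using (_≡_)
  open Binomial using (0<nC2)
  open QuarterBound using (quarter-bound)
  open SubsetProperties using (n<∣p∣+∣p∣⇒n<∣q∣+∣q∣⇒p∩q≢∅)
  open Links using (link; nC2<4deg⇒n<∣link∣+∣link∣)

  links-meet : ∀ {d n ε} (G : KGraph (2 + d) n) → 0ℚ ℚ.< ε → 2 ≤ n →
    (∀ D → ∣ D ∣ ≡ d → (+ 1 / 4 ℚ.+ ε) ℚ.* (+ (n C 2) / 1) ℚ.≤ + deg G D / 1) →
    ∀ A B → ∣ A ∣ ≡ d → ∣ B ∣ ≡ d → Nonempty (link G A ∩ link G B)
  links-meet {d} {n} G ε>0 2≤n codegree A B ∣A∣ ∣B∣ =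
    n<∣p∣+∣p∣⇒n<∣q∣+∣q∣⇒p∩q≢∅ (link-dense A ∣A∣) (link-dense B ∣B∣)
    where
    link-dense : ∀ D → ∣ D ∣ ≡ d → n < ∣ link G D ∣ + ∣ link G D ∣
    link-dense D ∣D∣ = nC2<4deg⇒n<∣link∣+∣link∣ G ∣D∣
      (quarter-bound {d = deg G D} ε>0 (0<nC2 2≤n) (codegree D ∣D∣))

module Connectivity where

  open import Data.Bool using (T)
  open import Data.Fin.Subset using (_∈_; _∉_; _⊆_; _⊂_; _∩_; _∪_; ∣_∣; ⁅_⁆; ⊤; Nonempty)
  open import Data.Fin.Subset.Properties
    using (∈⊤; ∣⊤∣≡n; ∣⁅x⁆∣≡1; x∈⁅x⁆; p⊂q⇒∣p∣<∣q∣; p∩q⊆p; p∩q⊆q; p⊆p∪q; x∈p∩q⁺; x∈p∩q⁻)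
  open import Data.Nat using (zero; suc; _+_; _≤_; _<_; z≤n; s≤s; _≤?_)
  open import Data.Nat.Properties
  open import Data.Product using (∃; ∃₂; _×_; _,_; proj₁)
  open import Function using (_∘_)
  open import Relation.Binary.Construct.Closure.ReflexiveTransitive using (Star; ε; _◅_)
  open import Relation.Binary.PropositionalEquality
  open import Relation.Nullary using (yes; no; contradiction)
  open SubsetProperties
  open Links using (link; ∈-link⁻)

  module _ {d n} (G : KGraph (3 + d) n)
           (links-meet : ∀ A B → ∣ A ∣ ≡ suc d → ∣ B ∣ ≡ suc d → Nonempty (link G A ∩ link G B))
           where

    d<∣e∣ : ∀ {e} → T (edge G e) → d < ∣ e ∣
    d<∣e∣ e-edge = subst (d <_) (sym (uniform G _ e-edge)) (m≤n+m (suc d) 2)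

    edge-through : ∀ {D} → ∣ D ∣ ≡ suc d → ∃ λ e → T (edge G e) × D ⊆ e
    edge-through {D} ∣D∣ =
      let x , x∈links = links-meet D D ∣D∣ ∣D∣
          _ , e , e-edge , D⊆e , _ = ∈-link⁻ G (proj₁ (x∈p∩q⁻ _ _ x∈links))
      in e , e-edge , D⊆e

    every-vertex-in-edge : suc d ≤ n → ∀ v → ∃ λ e → T (edge G e) × v ∈ e
    every-vertex-in-edge d<n v =
      let D , ⁅v⁆⊆D , _ , ∣D∣ = ⊆-extend (λ _ → ∈⊤) (subst (_≤ suc d) (sym (∣⁅x⁆∣≡1 v)) (s≤s z≤n))
                                          (subst (suc d ≤_) (sym (∣⊤∣≡n n)) d<n)
          e , e-edge , D⊆e = edge-through ∣D∣
      in e , e-edge , D⊆e (⁅v⁆⊆D (x∈⁅x⁆ v))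

    edges-through-meet : ∀ {S u v} → ∣ S ∣ ≡ d → u ∉ S → v ∉ S →
      ∃₂ λ g h → T (edge G g) × T (edge G h) × S ∪ ⁅ u ⁆ ⊆ g × S ∪ ⁅ v ⁆ ⊆ h × suc d ≤ ∣ g ∩ h ∣
    edges-through-meet {S} {u} {v} ∣S∣ u∉S v∉S =
      let x , x∈links                     = links-meet (S ∪ ⁅ u ⁆) (S ∪ ⁅ v ⁆) (∣S∪⁅y⁆∣ u∉S) (∣S∪⁅y⁆∣ v∉S)
          x∈link[S+u] , x∈link[S+v]       = x∈p∩q⁻ _ _ x∈links
          x∉S+u , g , g-edge , S+u⊆g , x∈g = ∈-link⁻ G x∈link[S+u]
          _     , h , h-edge , S+v⊆h , x∈h = ∈-link⁻ G x∈link[S+v]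
          S⊂g∩h : S ⊂ g ∩ h
          S⊂g∩h = p⊆q∩r⁺ (proj₁ (p∪⁅x⁆⊆q⁻ S+u⊆g)) (proj₁ (p∪⁅x⁆⊆q⁻ S+v⊆h)) ,
                  x , x∈p∩q⁺ (x∈g , x∈h) , x∉S+u ∘ p⊆p∪q ⁅ u ⁆
      in g , h , g-edge , h-edge , S+u⊆g , S+v⊆h , subst (_< ∣ g ∩ h ∣) ∣S∣ (p⊂q⇒∣p∣<∣q∣ S⊂g∩h)
      where
      ∣S∪⁅y⁆∣ : ∀ {y} → y ∉ S → ∣ S ∪ ⁅ y ⁆ ∣ ≡ suc d
      ∣S∪⁅y⁆∣ {y} y∉S = trans (∣p∪⁅x⁆∣≡1+∣p∣ S y y∉S) (cong suc ∣S∣)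

    two-steps-closer : ∀ {e f} → T (edge G e) → T (edge G f) → ∣ e ∩ f ∣ ≤ d →
      ∃₂ λ g h → LineAdj G (suc d) e g × LineAdj G (suc d) g h × ∣ e ∩ f ∣ < ∣ h ∩ f ∣
    two-steps-closer {e} {f} e-edge f-edge ∣e∩f∣≤d =
      let S , e∩f⊆S , S⊆e , ∣S∣ = ⊆-extend (p∩q⊆p e f) ∣e∩f∣≤d (<⇒≤ (d<∣e∣ e-edge))
          u , u∈e , u∉S         = ∣p∣<∣q∣⇒∃∈q∖p (subst (_< ∣ e ∣) (sym ∣S∣) (d<∣e∣ e-edge))
          v , v∈f , v∉e∩f       = ∣p∣<∣q∣⇒∃∈q∖p (≤-<-trans ∣e∩f∣≤d (d<∣e∣ f-edge))
          v∉S : v ∉ S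
          v∉S v∈S = v∉e∩f (x∈p∩q⁺ (S⊆e v∈S , v∈f))
          g , h , g-edge , h-edge , S+u⊆g , S+v⊆h , d<∣g∩h∣ = edges-through-meet ∣S∣ u∉S v∉S
          S⊆g , u∈g = p∪⁅x⁆⊆q⁻ S+u⊆g
          S⊆h , v∈h = p∪⁅x⁆⊆q⁻ S+v⊆h
          S⊂e∩g : S ⊂ e ∩ g
          S⊂e∩g = p⊆q∩r⁺ S⊆e S⊆g , u , x∈p∩q⁺ (u∈e , u∈g) , u∉S
          e∩f⊂h∩f : e ∩ f ⊂ h ∩ f
          e∩f⊂h∩f = p⊆q∩r⁺ (S⊆h ∘ e∩f⊆S) (p∩q⊆q e f) , v , x∈p∩q⁺ (v∈h , v∈f) , v∉e∩f
      in g , h , (e-edge , g-edge , subst (_< ∣ e ∩ g ∣) ∣S∣ (p⊂q⇒∣p∣<∣q∣ S⊂e∩g))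
               , (g-edge , h-edge , d<∣g∩h∣) , p⊂q⇒∣p∣<∣q∣ e∩f⊂h∩f

    walk : ∀ m {e f} → T (edge G e) → T (edge G f) → suc d ≤ m + ∣ e ∩ f ∣ → Star (LineAdj G (suc d)) e f
    walk m {e} {f} e-edge f-edge fuel with suc d ≤? ∣ e ∩ f ∣
    ... | yes close = (e-edge , f-edge , close) ◅ ε
    walk zero    e-edge f-edge fuel | no far = contradiction fuel far
    walk (suc m) {e} {f} e-edge f-edge fuel | no far =
      let g , h , e~g , g~h , closer = two-steps-closer e-edge f-edge (≤-pred (≰⇒> far))
          _ , h-edge , _ = g~h
      in e~g ◅ g~h ◅ walk m h-edge f-edge
                       (≤-trans fuel (subst (_≤ m + ∣ h ∩ f ∣) (+-suc m ∣ e ∩ f ∣) (+-monoʳ-≤ m closer)))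

    connected : suc d ≤ n → IsConnected G (suc d)
    connected d<n = every-vertex-in-edge d<n ,
                    λ e f e-edge f-edge → walk (suc d) e-edge f-edge (m≤m+n (suc d) _)

open import Data.Nat using (ℕ; _∸_; _≤_)
open import Data.Nat.Combinatorics using (_C_)
open import Data.Integer using (+_)
open import Data.Rational using (ℚ; _/_; _+_; _*_; _<_; 0ℚ) renaming (_≤_ to _≤ℚ_)
open import Data.Fin.Subset using (Subset; ∣_∣)
open import Data.Product using (Σ)
open import Relation.Binary.PropositionalEquality using (_≡_)

open import Data.Nat using (suc; z≤n; s≤s)
open import Data.Nat.Properties using (≤-trans; m+n≤o⇒n≤o)
open import Data.Product using (_,_)
open Codegree using (links-meet)
open Connectivity using (connected)

lemma3p2 : ∀ (k : ℕ) → 3 ≤ k → ∀ (ε : ℚ) → 0ℚ < ε →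
    Σ ℕ λ n₀ → ∀ (n : ℕ) → n₀ ≤ n → ∀ (G : KGraph k n) →
      (∀ (D : Subset n) → ∣ D ∣ ≡ k ∸ 2 →
        ((+ 1 / 4 + ε) * (+ (n C 2) / 1)) ≤ℚ (+ deg G D / 1)) →
      IsConnected G (k ∸ 2)
lemma3p2 (suc (suc (suc d))) (s≤s (s≤s (s≤s z≤n))) ε ε>0 = suc (suc (suc d)) , λ n k≤n G codegree →
  connected G (links-meet G ε>0 (≤-trans (s≤s (s≤s z≤n)) k≤n) codegree) (m+n≤o⇒n≤o 2 k≤n)
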